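{- Let $m\ge3$, let $a_1,\dots,a_m\ge2$ be integers and let $D_m\le S_m$ be the dihedral group of order $2m$ acting on $[m]$ as the symmetry group of a regular $m$-gon whose vertices are labelled $1,\dots,m$ in cyclic order. If $m$ is odd, then \[R_{D_m}(a_1,\dots,a_m)=\min\{a_i:1\le i\le m\}.\] If $m$ is even, then \[R_{D_m}(a_1,\dots,a_m)\le R_{S_2}(n_1,n_2),\] where $n_1=\min\{a_1,a_3,\dots,a_{m-1}\}$ and $n_2=\min\{a_2,a_4,\dots,a_m\}$.
   Context: An $m$-edge-coloured complete graph is a complete graph with each edge coloured from $[m]=\{1,\dots,m\}$. For $\Gamma\le S_m$, $\pi\in\Gamma$ and a vertex $v$, switching at $v$ with $\pi$ recolours every edge incident with $v$ of colour $i$ to colour $\pi(i)$, leaving other edges unchanged. Two such graphs on the same vertex set are $\Gamma$-switch equivalent if one is obtained from the other by a finite sequence of switches. $K_t^{(i)}$ is a complete graph on $t$ vertices with all edges of colour $i$. $R_\Gamma(a_1,\dots,a_m)$ is the least $n$ such that every $m$-edge-coloured complete graph on $n$ vertices is $\Gamma$-switch equivalent to one containing, for some $i$, a copy of $K_{a_i}^{(i)}$. In particular $R_{S_2}(n_1,n_2)$ is this number for $2$-edge-colourings with $S_2$ (switching at $v$ swaps colours $1$ and $2$ on edges at $v$). -}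

module Defs where

open import Data.Nat using (ℕ; zero; suc; _+_; _∸_; _%_; _≤_; _<_)
open import Data.Fin using (Fin; toℕ; _≟_) renaming (zero to fzero; suc to fsuc)
open import Data.Product using (Σ; ∃; _×_; _,_)
open import Data.Sum using (_⊎_)
open import Relation.Binary.PropositionalEquality using (_≡_; _≢_)
open import Relation.Nullary using (¬_; yes; no)
open import Relation.Binary.Construct.Closure.ReflexiveTransitive using (Star)

-- Colours 1..m of the paper are represented by Fin m (colour j+1 ↦ index j).
-- Only values c x y with x ≢ y matter; colourings are required to be symmetric.
Colouring : ℕ → ℕ → Set
Colouring n m = Fin n → Fin n → Fin m

Symmetric : ∀ {n m} → Colouring n m → Set
Symmetric c = ∀ x y → c x y ≡ c y x

-- A "group" of colour permutations, given as a predicate on maps Fin m → Fin m.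
PermSet : ℕ → Set₁
PermSet m = (Fin m → Fin m) → Set

switch : ∀ {n m} → (Fin m → Fin m) → Fin n → Colouring n m → Colouring n m
switch π v c x y with x ≟ v | y ≟ v
... | yes _ | _     = π (c x y)
... | no _  | yes _ = π (c x y)
... | no _  | no _  = c x y

SwitchStep : ∀ {n m} → PermSet m → Colouring n m → Colouring n m → Set
SwitchStep Γ c d = Σ _ λ π → Γ π × Σ _ λ v → ∀ x y → d x y ≡ switch π v c x y

SwitchEquiv : ∀ {n m} → PermSet m → Colouring n m → Colouring n m → Set
SwitchEquiv Γ = Star (SwitchStep Γ)

ContainsMono : ∀ {n m} → Colouring n m → ℕ → Fin m → Set
ContainsMono {n} c t i =
  Σ (Fin t → Fin n) λ f →
    (∀ p q → f p ≡ f q → p ≡ q) × (∀ p q → p ≢ q → c (f p) (f q) ≡ i)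

RamseyProp : ∀ {m} → PermSet m → (Fin m → ℕ) → ℕ → Set
RamseyProp {m} Γ a n =
  (c : Colouring n m) → Symmetric c →
    Σ (Colouring n m) λ d → SwitchEquiv Γ c d × Σ (Fin m) λ i → ContainsMono d (a i) i

IsR : ∀ {m} → PermSet m → (Fin m → ℕ) → ℕ → Set
IsR Γ a n = RamseyProp Γ a n × (∀ k → k < n → ¬ RamseyProp Γ a k)

-- a mod m (m = 0 never used)
modm : ℕ → ℕ → ℕ
modm a zero = a
modm a (suc m) = a % suc m

-- Dihedral group D_m acting on the m-gon with vertices 0..m-1 in cyclic order:
-- rotations i ↦ k + i and reflections i ↦ k − i (mod m).
Dihedral : (m : ℕ) → PermSet m
Dihedral m π = Σ ℕ λ k →
    (∀ i → toℕ (π i) ≡ modm (k + toℕ i) m)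
  ⊎ (∀ i → toℕ (π i) ≡ modm (k + (m ∸ toℕ i)) m)

swap2 : Fin 2 → Fin 2
swap2 fzero = fsuc fzero
swap2 (fsuc _) = fzero

Sym2 : PermSet 2
Sym2 π = (∀ i → π i ≡ i) ⊎ (∀ i → π i ≡ swap2 i)

pair : ℕ → ℕ → Fin 2 → ℕ
pair n₁ n₂ fzero = n₁
pair n₁ n₂ (fsuc _) = n₂

-- For involutions π and ρ, switching with π at u, ρ at v, π at u and ρ at v leaves every edge
-- except uv unchanged and applies ρπρπ to the colour of uv. For the reflections i ↦ −i and
-- i ↦ a − i of the m-gon this adds 2a, so the colour of a single edge can be moved to any colour
-- of the same parity, and to any colour at all when m is odd. For odd m every clique can therefore
-- be made monochromatic in any colour j, so min aᵢ vertices suffice, while fewer vertices cannot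
-- hold any K_{aᵢ}. For even m, dihedral switches act on the parities of colours exactly as
-- S₂-switches act on 2-colourings, and each S₂-switch lifts to a reflection. Lifting an S₂-switching
-- that produces a monochromatic K_{n_β} in the parity colouring yields a clique of one parity,
-- recoloured edge by edge to a colour j of that parity with a_j = n_β; projecting shows conversely
-- that R_{D_m} < R_{S₂} is impossible, so in fact equality holds.

module Submission where

open import Defs
open import Level using (0ℓ)
open import Data.Nat using (ℕ; zero; suc; _+_; _*_; _∸_; _≤_; _<_; _%_; _/_; NonZero; >-nonZero; s≤s; z≤n)
open import Data.Nat.Properties using (+-assoc; +-identityʳ; m+[n∸m]≡n; m∸n+n≡m; <⇒≤; <-≤-trans; <-irrefl; ≤-refl; ≤-trans; n≤1+n)
open import Data.Nat.DivMod using (_mod_; m≡m%n+[m/n]*n; m/n*n≡m; m%n%n≡m%n; %-distribˡ-+; [m+n]%n≡m%n; [m+kn]%n≡m%n; m*n%n≡0; m<n⇒m%n≡m; m∣n⇒o%n%m≡o%m; %-remove-+ʳ)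
open import Data.Nat.Divisibility using (_∣_; m%n≡0⇒n∣m)
open import Data.Nat.Tactic.RingSolver using (solve-∀)
open import Data.Fin using (Fin; toℕ; _≟_; inject≤) renaming (zero to fzero; suc to fsuc)
open import Data.Fin.Properties using (toℕ-injective; toℕ-fromℕ<; toℕ<n; toℕ-inject≤; inject≤-injective; pigeonhole)
open import Data.Product using (Σ; _×_; _,_; proj₁; proj₂)
open import Data.Sum using (_⊎_; inj₁; inj₂)
open import Data.Unit using (⊤; tt)
open import Data.Empty using (⊥-elim)
open import Data.List using (List; []; _∷_; cartesianProduct; allFin)
open import Data.List.Membership.Propositional using (_∈_)
open import Data.List.Membership.Propositional.Properties using (∈-cartesianProduct⁺; ∈-allFin)
open import Data.List.Relation.Unary.Any using (here; there)
open import Function using (id; _∘_)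
open import Relation.Binary.Bundles using (Setoid)
import Relation.Binary.Reasoning.Setoid as SetoidReasoning
open import Relation.Binary.PropositionalEquality using (_≡_; _≢_; refl; sym; trans; cong; subst; module ≡-Reasoning)
open import Relation.Nullary using (¬_; Dec; yes; no)
open import Relation.Nullary.Decidable using (_⊎-dec_)
open import Relation.Binary.Construct.Closure.ReflexiveTransitive using (ε; _◅_; _◅◅_)

private
  variable
    n m k t : ℕ
    Γ : PermSet m
    Δ : PermSet k

Incident : Fin n → Fin n → Fin n → Set
Incident v x y = x ≡ v ⊎ y ≡ v

incident? : (v x y : Fin n) → Dec (Incident v x y)
incident? v x y = (x ≟ v) ⊎-dec (y ≟ v)

switch-incident : ∀ (π : Fin m → Fin m) (c : Colouring n m) {v x y} → Incident v x y →
                  switch π v c x y ≡ π (c x y)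
switch-incident π c {v} {x} {y} inc with x ≟ v | y ≟ v | inc
... | yes _ | _     | _         = refl
... | no _  | yes _ | _         = refl
... | no x≢v | no _ | inj₁ x≡v = ⊥-elim (x≢v x≡v)
... | no _  | no y≢v | inj₂ y≡v = ⊥-elim (y≢v y≡v)

switch-away : ∀ (π : Fin m → Fin m) (c : Colouring n m) {v x y} → ¬ Incident v x y →
              switch π v c x y ≡ c x y
switch-away π c {v} {x} {y} ¬inc with x ≟ v | y ≟ v
... | yes x≡v | _       = ⊥-elim (¬inc (inj₁ x≡v))
... | no _    | yes y≡v = ⊥-elim (¬inc (inj₂ y≡v))
... | no _    | no _    = refl

switch-symmetric : ∀ (π : Fin m → Fin m) v (c : Colouring n m) → Symmetric c → Symmetric (switch π v c)
switch-symmetric π v c c-sym x y with x ≟ v | y ≟ v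
... | yes _ | yes _ = cong π (c-sym x y)
... | yes _ | no _  = cong π (c-sym x y)
... | no _  | yes _ = cong π (c-sym x y)
... | no _  | no _  = c-sym x y

SwitchEquiv-symmetric : {c d : Colouring n m} → SwitchEquiv Γ c d → Symmetric c → Symmetric d
SwitchEquiv-symmetric ε c-sym = c-sym
SwitchEquiv-symmetric ((π , _ , v , d≗) ◅ rest) c-sym =
  SwitchEquiv-symmetric rest λ x y → trans (d≗ x y) (trans (switch-symmetric π v _ c-sym x y) (sym (d≗ y x)))

switch-step : {π : Fin m → Fin m} {c : Colouring n m} → Γ π → ∀ v → SwitchStep Γ c (switch π v c)
switch-step {π = π} π∈Γ v = π , π∈Γ , v , λ _ _ → refl

_≗₂_ : Colouring n m → Colouring n m → Set
c ≗₂ d = ∀ x y → c x y ≡ d x y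

switch-cong : ∀ (π : Fin m → Fin m) v {c d : Colouring n m} → c ≗₂ d → switch π v c ≗₂ switch π v d
switch-cong π v c≗d x y with x ≟ v | y ≟ v
... | yes _ | _     = cong π (c≗d x y)
... | no _  | yes _ = cong π (c≗d x y)
... | no _  | no _  = c≗d x y

mapColours : (Fin m → Fin k) → Colouring n m → Colouring n k
mapColours g c x y = g (c x y)

Intertwines : (Fin m → Fin k) → (Fin m → Fin m) → (Fin k → Fin k) → Set
Intertwines g π σ = ∀ z → g (π z) ≡ σ (g z)

switch-mapColours : ∀ {g : Fin m → Fin k} {π σ} → Intertwines g π σ → ∀ v (c : Colouring n m) →
                    mapColours g (switch π v c) ≗₂ switch σ v (mapColours g c)
switch-mapColours g∘π≗σ∘g v c x y with x ≟ v | y ≟ v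
... | yes _ | _     = g∘π≗σ∘g (c x y)
... | no _  | yes _ = g∘π≗σ∘g (c x y)
... | no _  | no _  = refl

map-SwitchEquiv : {g : Fin m → Fin k} →
  (∀ π → Γ π → Σ _ λ σ → Δ σ × Intertwines g π σ) →
  {c₀ : Colouring n k} {c d : Colouring n m} → c₀ ≗₂ mapColours g c → SwitchEquiv Γ c d →
  Σ (Colouring n k) λ d₀ → SwitchEquiv Δ c₀ d₀ × d₀ ≗₂ mapColours g d
map-SwitchEquiv descends {c₀} c₀≗ ε = c₀ , ε , c₀≗
map-SwitchEquiv {g = g} descends {c₀} {c} c₀≗ (_◅_ {j = c₁} (π , π∈Γ , v , c₁≗) rest) with descends π π∈Γ
... | σ , σ∈Δ , g∘π≗σ∘g =
  let d₀ , rest₀ , d₀≗ = map-SwitchEquiv descends next≗ rest in d₀ , switch-step σ∈Δ v ◅ rest₀ , d₀≗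
  where
    next≗ : switch σ v c₀ ≗₂ mapColours g c₁
    next≗ x y = trans (switch-cong σ v c₀≗ x y)
                      (trans (sym (switch-mapColours g∘π≗σ∘g v c x y)) (cong g (sym (c₁≗ x y))))

lift-SwitchEquiv : {g : Fin m → Fin k} →
  (∀ σ → Δ σ → Σ _ λ π → Γ π × Intertwines g π σ) →
  {e₀ e : Colouring n k} {c : Colouring n m} → e₀ ≗₂ mapColours g c → SwitchEquiv Δ e₀ e →
  Σ (Colouring n m) λ c′ → SwitchEquiv Γ c c′ × e ≗₂ mapColours g c′
lift-SwitchEquiv lifts {c = c} e₀≗ ε = c , ε , e₀≗
lift-SwitchEquiv {g = g} lifts {c = c} e₀≗ (_◅_ {j = e₁} (σ , σ∈Δ , v , e₁≗) rest) with lifts σ σ∈Δ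
... | π , π∈Γ , g∘π≗σ∘g =
  let c′ , chain , e≗ = lift-SwitchEquiv lifts next≗ rest in c′ , switch-step π∈Γ v ◅ chain , e≗
  where
    next≗ : e₁ ≗₂ mapColours g (switch π v c)
    next≗ x y = trans (e₁≗ x y) (trans (switch-cong σ v e₀≗ x y) (sym (switch-mapColours g∘π≗σ∘g v c x y)))

ContainsMono-map : ∀ {g : Fin m → Fin k} {d : Colouring n m} {d′ : Colouring n k} {i} →
  d′ ≗₂ mapColours g d → ContainsMono d t i → ContainsMono d′ t (g i)
ContainsMono-map {g = g} d′≗ (f , f-inj , mono) = f , f-inj , λ p q p≢q → trans (d′≗ _ _) (cong g (mono p q p≢q))

ContainsMono-≤ : ∀ {s} {d : Colouring n m} {i} → s ≤ t → ContainsMono d t i → ContainsMono d s i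
ContainsMono-≤ s≤t (f , f-inj , mono) =
  f ∘ embed , (λ p q fp≡fq → inject≤-injective s≤t s≤t p q (f-inj _ _ fp≡fq)) ,
  λ p q p≢q → mono _ _ (p≢q ∘ inject≤-injective s≤t s≤t p q)
  where embed = λ p → inject≤ p s≤t

¬ContainsMono-oversized : ∀ {d : Colouring n m} {i} → n < t → ¬ ContainsMono d t i
¬ContainsMono-oversized n<t (f , f-inj , _) with pigeonhole n<t f
... | p , q , p<q , fp≡fq = <-irrefl (cong toℕ (f-inj p q fp≡fq)) p<q

module _ {n m : ℕ} (π ρ : Fin m → Fin m) (u v : Fin n) (c : Colouring n m) where
  private
    c₁ = switch π u c
    c₂ = switch ρ v c₁
    c₃ = switch π u c₂

  commutatorSwitch : Colouring n m
  commutatorSwitch = switch ρ v c₃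

  commutatorSwitch-equiv : ∀ {Γ} → Γ π → Γ ρ → SwitchEquiv Γ c commutatorSwitch
  commutatorSwitch-equiv π∈Γ ρ∈Γ =
    switch-step π∈Γ u ◅ switch-step ρ∈Γ v ◅ switch-step π∈Γ u ◅ switch-step ρ∈Γ v ◅ ε

  commutatorSwitch-edge : ∀ {x y} → Incident u x y → Incident v x y →
                          commutatorSwitch x y ≡ ρ (π (ρ (π (c x y))))
  commutatorSwitch-edge {x} {y} iu iv = begin
    switch ρ v c₃ x y             ≡⟨ switch-incident ρ c₃ iv ⟩
    ρ (switch π u c₂ x y)         ≡⟨ cong ρ (switch-incident π c₂ iu) ⟩
    ρ (π (switch ρ v c₁ x y))     ≡⟨ cong (ρ ∘ π) (switch-incident ρ c₁ iv) ⟩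
    ρ (π (ρ (switch π u c x y)))  ≡⟨ cong (ρ ∘ π ∘ ρ) (switch-incident π c iu) ⟩
    ρ (π (ρ (π (c x y))))         ∎
    where open ≡-Reasoning

  commutatorSwitch-elsewhere : (∀ z → π (π z) ≡ z) → (∀ z → ρ (ρ z) ≡ z) →
    ∀ {x y} → ¬ (Incident u x y × Incident v x y) → commutatorSwitch x y ≡ c x y
  commutatorSwitch-elsewhere π-inv ρ-inv {x} {y} ¬both = by-incidence (incident? u x y) (incident? v x y)
    where
      open ≡-Reasoning
      by-incidence : Dec (Incident u x y) → Dec (Incident v x y) → commutatorSwitch x y ≡ c x y
      by-incidence (yes iu) (yes iv) = ⊥-elim (¬both (iu , iv))
      by-incidence (yes iu) (no ¬iv) = begin
        switch ρ v c₃ x y         ≡⟨ switch-away ρ c₃ ¬iv ⟩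
        switch π u c₂ x y         ≡⟨ switch-incident π c₂ iu ⟩
        π (switch ρ v c₁ x y)     ≡⟨ cong π (switch-away ρ c₁ ¬iv) ⟩
        π (switch π u c x y)      ≡⟨ cong π (switch-incident π c iu) ⟩
        π (π (c x y))             ≡⟨ π-inv (c x y) ⟩
        c x y                     ∎
      by-incidence (no ¬iu) (yes iv) = begin
        switch ρ v c₃ x y         ≡⟨ switch-incident ρ c₃ iv ⟩
        ρ (switch π u c₂ x y)     ≡⟨ cong ρ (switch-away π c₂ ¬iu) ⟩
        ρ (switch ρ v c₁ x y)     ≡⟨ cong ρ (switch-incident ρ c₁ iv) ⟩
        ρ (ρ (switch π u c x y))  ≡⟨ cong (ρ ∘ ρ) (switch-away π c ¬iu) ⟩
        ρ (ρ (c x y))             ≡⟨ ρ-inv (c x y) ⟩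
        c x y                     ∎
      by-incidence (no ¬iu) (no ¬iv) = begin
        switch ρ v c₃ x y         ≡⟨ switch-away ρ c₃ ¬iv ⟩
        switch π u c₂ x y         ≡⟨ switch-away π c₂ ¬iu ⟩
        switch ρ v c₁ x y         ≡⟨ switch-away ρ c₁ ¬iv ⟩
        switch π u c x y          ≡⟨ switch-away π c ¬iu ⟩
        c x y                     ∎

incident-both : ∀ {u v x y : Fin n} {c : Colouring n m} → u ≢ v → Symmetric c →
                Incident u x y → Incident v x y → c x y ≡ c u v
incident-both u≢v c-sym (inj₁ refl) (inj₁ refl) = ⊥-elim (u≢v refl)
incident-both u≢v c-sym (inj₁ refl) (inj₂ refl) = refl
incident-both u≢v c-sym (inj₂ refl) (inj₁ refl) = c-sym _ _
incident-both u≢v c-sym (inj₂ refl) (inj₂ refl) = ⊥-elim (u≢v refl)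

record EdgeRecolouring (Γ : PermSet m) (x j : Fin m) : Set where
  field
    π ρ          : Fin m → Fin m
    π∈Γ          : Γ π
    ρ∈Γ          : Γ ρ
    π-involutive : ∀ z → π (π z) ≡ z
    ρ-involutive : ∀ z → ρ (ρ z) ≡ z
    recolours    : ρ (π (ρ (π x))) ≡ j

recolourEdge : ∀ {c : Colouring n m} {u v j} → EdgeRecolouring Γ (c u v) j → u ≢ v → Symmetric c →
  Σ (Colouring n m) λ d → SwitchEquiv Γ c d × d u v ≡ j × (∀ x y → d x y ≡ j ⊎ d x y ≡ c x y)
recolourEdge {c = c} {u} {v} {j} R u≢v c-sym =
  commutatorSwitch π ρ u v c , commutatorSwitch-equiv π ρ u v c π∈Γ ρ∈Γ , on-edge (inj₁ refl) (inj₂ refl) , dichotomy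
  where
    open EdgeRecolouring R
    on-edge : ∀ {x y} → Incident u x y → Incident v x y → commutatorSwitch π ρ u v c x y ≡ j
    on-edge iu iv = trans (commutatorSwitch-edge π ρ u v c iu iv)
                          (trans (cong (ρ ∘ π ∘ ρ ∘ π) (incident-both u≢v c-sym iu iv)) recolours)
    dichotomy : ∀ x y → commutatorSwitch π ρ u v c x y ≡ j ⊎ commutatorSwitch π ρ u v c x y ≡ c x y
    dichotomy x y with incident? u x y | incident? v x y
    ... | yes iu | yes iv = inj₁ (on-edge iu iv)
    ... | no ¬iu | _      = inj₂ (commutatorSwitch-elsewhere π ρ u v c π-involutive ρ-involutive (¬iu ∘ proj₁))
    ... | yes _  | no ¬iv = inj₂ (commutatorSwitch-elsewhere π ρ u v c π-involutive ρ-involutive (¬iv ∘ proj₂))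

dichotomy-preserves : ∀ {Q : Fin m → Set} {j a b} → Q j → a ≡ j ⊎ a ≡ b → Q b → Q a
dichotomy-preserves Qj (inj₁ refl) _  = Qj
dichotomy-preserves _  (inj₂ refl) Qb = Qb

module _ {Γ : PermSet m} {j : Fin m} (P : Fin m → Set) (Pj : P j)
         (recolouring : ∀ x → P x → EdgeRecolouring Γ x j)
         (f : Fin t → Fin n) (f-injective : ∀ p q → f p ≡ f q → p ≡ q) where

  AllowedOnClique : Colouring n m → Set
  AllowedOnClique c = ∀ p q → p ≢ q → P (c (f p) (f q))

  recolourPairs : (L : List (Fin t × Fin t)) (c : Colouring n m) → Symmetric c → AllowedOnClique c →
    Σ (Colouring n m) λ d → SwitchEquiv Γ c d ×
      (∀ {p q} → (p , q) ∈ L → p ≢ q → d (f p) (f q) ≡ j) × (∀ x y → c x y ≡ j → d x y ≡ j)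
  recolourPairs [] c _ _ = c , ε , (λ ()) , λ _ _ → id
  recolourPairs ((p , q) ∷ L) c c-sym P-c with p ≟ q
  ... | yes p≡q =
    let d , chain , done , keeps = recolourPairs L c c-sym P-c
    in d , chain , (λ { (here refl) p≢q → ⊥-elim (p≢q p≡q) ; (there mem) → done mem }) , keeps
  ... | no p≢q =
    let c₁ , chain₁ , c₁-pq , c₁-dich = recolourEdge (recolouring _ (P-c p q p≢q)) (p≢q ∘ f-injective p q) c-sym
        d , chain , done , keeps = recolourPairs L c₁ (SwitchEquiv-symmetric chain₁ c-sym)
          λ p′ q′ p′≢q′ → dichotomy-preserves Pj (c₁-dich (f p′) (f q′)) (P-c p′ q′ p′≢q′)
    in d , chain₁ ◅◅ chain , (λ { (here refl) _ → keeps _ _ c₁-pq ; (there mem) → done mem }) ,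
       λ x y cxy≡j → keeps x y (dichotomy-preserves {Q = _≡ j} refl (c₁-dich x y) cxy≡j)

  monochromaticClique : (c : Colouring n m) → Symmetric c → AllowedOnClique c →
    Σ (Colouring n m) λ d → SwitchEquiv Γ c d × ContainsMono d t j
  monochromaticClique c c-sym P-c with recolourPairs (cartesianProduct (allFin t) (allFin t)) c c-sym P-c
  ... | d , chain , done , _ = d , chain , f , f-injective , λ p q → done (∈-cartesianProduct⁺ (∈-allFin p) (∈-allFin q))

-- Record rather than a synonym for x % d ≡ y % d, so that x and y can be inferred.
module Congruence (d : ℕ) .{{_ : NonZero d}} where

  infix 4 _≋_
  record _≋_ (x y : ℕ) : Set where
    constructor mod-eq
    field %-eq : x % d ≡ y % d
  open _≋_ public

  ≋-setoid : Setoid 0ℓ 0ℓ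
  ≋-setoid = record
    { Carrier       = ℕ
    ; _≈_           = _≋_
    ; isEquivalence = record
      { refl  = mod-eq refl
      ; sym   = λ x≋y → mod-eq (sym (%-eq x≋y))
      ; trans = λ x≋y y≋z → mod-eq (trans (%-eq x≋y) (%-eq y≋z))
      }
    }

  open Setoid ≋-setoid public using () renaming (reflexive to ≡⇒≋; trans to ≋-trans)
  module ≋-Reasoning = SetoidReasoning ≋-setoid

  +-cong : ∀ {a a′ b b′} → a ≋ a′ → b ≋ b′ → a + b ≋ a′ + b′
  +-cong {a} {a′} {b} {b′} (mod-eq a≡a′) (mod-eq b≡b′) = mod-eq (begin
    (a + b) % d               ≡⟨ %-distribˡ-+ a b d ⟩
    (a % d + b % d) % d       ≡⟨ cong (λ r → (r + b % d) % d) a≡a′ ⟩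
    (a′ % d + b % d) % d      ≡⟨ cong (λ r → (a′ % d + r) % d) b≡b′ ⟩
    (a′ % d + b′ % d) % d     ≡⟨ %-distribˡ-+ a′ b′ d ⟨
    (a′ + b′) % d             ∎)
    where open ≡-Reasoning

  +-congˡ : ∀ a {b b′} → b ≋ b′ → a + b ≋ a + b′
  +-congˡ a = +-cong (mod-eq (refl {x = a % d}))

  +-congʳ : ∀ {a a′} b → a ≋ a′ → a + b ≋ a′ + b
  +-congʳ b a≋a′ = +-cong a≋a′ (mod-eq (refl {x = b % d}))

  +-multiple : ∀ x k → x + k * d ≋ x
  +-multiple x k = mod-eq ([m+kn]%n≡m%n x k d)

  +-modulus : ∀ x → x + d ≋ x
  +-modulus x = mod-eq ([m+n]%n≡m%n x d)

  toℕ-mod : ∀ x → toℕ (x mod d) ≋ x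
  toℕ-mod x = mod-eq (trans (cong (_% d) (toℕ-fromℕ< _)) (m%n%n≡m%n x d))

  toℕ-≋-injective : ∀ {i j : Fin d} → toℕ i ≋ toℕ j → i ≡ j
  toℕ-≋-injective {i} {j} (mod-eq i≡j) =
    toℕ-injective (trans (sym (m<n⇒m%n≡m (toℕ<n i))) (trans i≡j (m<n⇒m%n≡m (toℕ<n j))))

  +-∸-cancel : ∀ j x → x ≤ d → j + (d ∸ x) + x ≋ j
  +-∸-cancel j x x≤d = ≋-trans (≡⇒≋ (trans (+-assoc j (d ∸ x) x) (cong (j +_) (m∸n+n≡m x≤d)))) (+-modulus j)

modm≡% : ∀ x m .{{_ : NonZero m}} → modm x m ≡ x % m
modm≡% x (suc m) = refl

halve-even : ∀ t → t % 2 ≡ 0 → t / 2 + t / 2 ≡ t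
halve-even t t-even = trans (double (t / 2)) (m/n*n≡m (m%n≡0⇒n∣m t 2 t-even))
  where
    double : ∀ a → a + a ≡ a * 2
    double = solve-∀

module Reflections (m : ℕ) .{{_ : NonZero m}} where
  open Congruence m

  reflect : ℕ → Fin m → Fin m
  reflect k i = (k + (m ∸ toℕ i)) mod m

  toℕ-reflect : ∀ k i → toℕ (reflect k i) ≡ modm (k + (m ∸ toℕ i)) m
  toℕ-reflect k i = trans (toℕ-fromℕ< _) (sym (modm≡% _ m))

  reflect-dihedral : ∀ k → Dihedral m (reflect k)
  reflect-dihedral k = k , inj₂ (toℕ-reflect k)

  reflect-+ : ∀ k i → toℕ (reflect k i) + toℕ i ≋ k
  reflect-+ k i = ≋-trans (+-congʳ (toℕ i) (toℕ-mod _)) (+-∸-cancel k (toℕ i) (<⇒≤ (toℕ<n i)))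

  reflect-involutive : ∀ k i → reflect k (reflect k i) ≡ i
  reflect-involutive k i = toℕ-≋-injective (begin
    toℕ (reflect k r)              ≈⟨ toℕ-mod _ ⟩
    k + (m ∸ toℕ r)                ≈⟨ +-congʳ (m ∸ toℕ r) (reflect-+ k i) ⟨
    toℕ r + toℕ i + (m ∸ toℕ r)    ≡⟨ regroup (toℕ r) (toℕ i) (m ∸ toℕ r) ⟩
    toℕ i + (toℕ r + (m ∸ toℕ r))  ≡⟨ cong (toℕ i +_) (m+[n∸m]≡n (<⇒≤ (toℕ<n r))) ⟩
    toℕ i + m                      ≈⟨ +-modulus (toℕ i) ⟩
    toℕ i                          ∎)
    where
      open ≋-Reasoning
      r = reflect k i
      regroup : ∀ a b c → a + b + c ≡ b + (a + c)
      regroup = solve-∀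

  -- Adjacent terms of r₄ + r₃ + r₂ + r₁ + x sum to a, 0, a, 0; group them both ways.
  reflect-commutator : ∀ a x → toℕ (reflect a (reflect 0 (reflect a (reflect 0 x)))) ≋ a + a + toℕ x
  reflect-commutator a x = begin
    toℕ r₄                                           ≡⟨ trans (+-identityʳ _) (+-identityʳ _) ⟨
    toℕ r₄ + 0 + 0                                   ≈⟨ +-cong (+-congˡ (toℕ r₄) (reflect-+ 0 r₂)) (reflect-+ 0 x) ⟨
    toℕ r₄ + (toℕ r₃ + toℕ r₂) + (toℕ r₁ + toℕ x)    ≡⟨ regroup (toℕ r₄) (toℕ r₃) (toℕ r₂) (toℕ r₁) (toℕ x) ⟩
    (toℕ r₄ + toℕ r₃) + (toℕ r₂ + toℕ r₁) + toℕ x    ≈⟨ +-congʳ (toℕ x) (+-cong (reflect-+ a r₃) (reflect-+ a r₁)) ⟩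
    a + a + toℕ x                                    ∎
    where
      open ≋-Reasoning
      r₁ = reflect 0 x
      r₂ = reflect a r₁
      r₃ = reflect 0 r₂
      r₄ = reflect a r₃
      regroup : ∀ a b c d e → a + (b + c) + (d + e) ≡ (a + b) + (c + d) + e
      regroup = solve-∀

  reflections-recolour : ∀ a {x j} → a + a ≋ toℕ j + (m ∸ toℕ x) → EdgeRecolouring (Dihedral m) x j
  reflections-recolour a {x} {j} a+a≋ = record
    { π            = reflect 0
    ; ρ            = reflect a
    ; π∈Γ          = reflect-dihedral 0
    ; ρ∈Γ          = reflect-dihedral a
    ; π-involutive = reflect-involutive 0
    ; ρ-involutive = reflect-involutive a
    ; recolours    = toℕ-≋-injective (≋-trans (reflect-commutator a x)
        (≋-trans (+-congʳ (toℕ x) a+a≋) (+-∸-cancel (toℕ j) (toℕ x) (<⇒≤ (toℕ<n x)))))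
    }

  -- For m = 2q + 1, q + 1 is a half of 1 modulo m.
  odd-recolouring : m % 2 ≡ 1 → ∀ x j → EdgeRecolouring (Dihedral m) x j
  odd-recolouring m-odd x j = reflections-recolour (suc q * gap) (begin
    suc q * gap + suc q * gap  ≡⟨ double q gap ⟩
    gap + gap * (1 + q * 2)    ≡⟨ cong (λ r → gap + gap * r) m≡1+2q ⟨
    gap + gap * m              ≈⟨ +-multiple gap gap ⟩
    gap                        ∎)
    where
      open ≋-Reasoning
      q = m / 2
      gap = toℕ j + (m ∸ toℕ x)
      m≡1+2q : m ≡ 1 + q * 2
      m≡1+2q = trans (m≡m%n+[m/n]*n m 2) (cong (_+ q * 2) m-odd)
      double : ∀ q t → suc q * t + suc q * t ≡ t + t * (1 + q * 2)
      double = solve-∀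

swap2-involutive : ∀ b → swap2 (swap2 b) ≡ b
swap2-involutive fzero        = refl
swap2-involutive (fsuc fzero) = refl

toℕ-swap2 : ∀ b → toℕ (swap2 b) ≡ suc (toℕ b) % 2
toℕ-swap2 fzero        = refl
toℕ-swap2 (fsuc fzero) = refl

flips : ℕ → Fin 2 → Fin 2
flips zero    = id
flips (suc k) = swap2 ∘ flips k

flips-sym2 : ∀ k → Sym2 (flips k)
flips-sym2 zero = inj₁ λ _ → refl
flips-sym2 (suc k) with flips-sym2 k
... | inj₁ flips≗id   = inj₂ λ b → cong swap2 (flips≗id b)
... | inj₂ flips≗swap = inj₁ λ b → trans (cong swap2 (flips≗swap b)) (swap2-involutive b)

toℕ-flips : ∀ k b → toℕ (flips k b) ≡ (k + toℕ b) % 2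
toℕ-flips zero    b = sym (m<n⇒m%n≡m (toℕ<n b))
toℕ-flips (suc k) b = begin
  toℕ (swap2 (flips k b))     ≡⟨ toℕ-swap2 (flips k b) ⟩
  suc (toℕ (flips k b)) % 2   ≡⟨ cong (λ r → suc r % 2) (toℕ-flips k b) ⟩
  (1 + (k + toℕ b) % 2) % 2   ≡⟨ %-distribˡ-+ 1 (k + toℕ b) 2 ⟨
  suc (k + toℕ b) % 2         ∎
  where open ≡-Reasoning

module Parity (m : ℕ) .{{_ : NonZero m}} (2∣m : 2 ∣ m) where
  open Reflections m
  module Mod₂ = Congruence 2

  parity : Fin m → Fin 2
  parity i = toℕ i mod 2

  toℕ-parity : ∀ i → toℕ (parity i) ≡ toℕ i % 2
  toℕ-parity i = toℕ-fromℕ< _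

  %m%2 : ∀ o → o % m % 2 ≡ o % 2
  %m%2 o = m∣n⇒o%n%m≡o%m 2 m o 2∣m

  -- m ∸ x and x differ by m − 2x, which is even.
  +∸-parity : ∀ k x → x ≤ m → (k + (m ∸ x)) % 2 ≡ (k + x) % 2
  +∸-parity k x x≤m = begin
    (k + (m ∸ x)) % 2            ≡⟨ [m+kn]%n≡m%n (k + (m ∸ x)) x 2 ⟨
    (k + (m ∸ x) + x * 2) % 2    ≡⟨ cong (_% 2) (regroup k (m ∸ x) x) ⟩
    (k + x + ((m ∸ x) + x)) % 2  ≡⟨ cong (λ r → (k + x + r) % 2) (m∸n+n≡m x≤m) ⟩
    (k + x + m) % 2              ≡⟨ %-remove-+ʳ (k + x) 2∣m ⟩
    (k + x) % 2                  ∎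
    where
      open ≡-Reasoning
      regroup : ∀ k y x → k + y + x * 2 ≡ k + x + (y + x)
      regroup = solve-∀

  parity-intertwines : ∀ (π : Fin m → Fin m) k → (∀ i → toℕ (π i) % 2 ≡ (k + toℕ i) % 2) →
                       Intertwines parity π (flips k)
  parity-intertwines π k π-parity z = toℕ-injective (begin
    toℕ (parity (π z))              ≡⟨ toℕ-parity (π z) ⟩
    toℕ (π z) % 2                   ≡⟨ π-parity z ⟩
    (k + toℕ z) % 2                 ≡⟨ Mod₂.%-eq (Mod₂.+-congˡ k (Mod₂.toℕ-mod (toℕ z))) ⟨
    (k + toℕ (parity z)) % 2        ≡⟨ toℕ-flips k (parity z) ⟨
    toℕ (flips k (parity z))        ∎)
    where open ≡-Reasoning

  dihedral-descends : ∀ π → Dihedral m π → Σ _ λ σ → Sym2 σ × Intertwines parity π σ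
  dihedral-descends π (k , inj₁ rotation) = flips k , flips-sym2 k , parity-intertwines π k λ i →
    trans (cong (_% 2) (trans (rotation i) (modm≡% _ m))) (%m%2 (k + toℕ i))
  dihedral-descends π (k , inj₂ reflection) = flips k , flips-sym2 k , parity-intertwines π k λ i →
    trans (cong (_% 2) (trans (reflection i) (modm≡% _ m)))
          (trans (%m%2 (k + (m ∸ toℕ i))) (+∸-parity k (toℕ i) (<⇒≤ (toℕ<n i))))

  reflect-parity : ∀ k → Intertwines parity (reflect k) (flips k)
  reflect-parity k = proj₂ (proj₂ (dihedral-descends (reflect k) (reflect-dihedral k)))

  dihedral-lifts : ∀ σ → Sym2 σ → Σ _ λ π → Dihedral m π × Intertwines parity π σ
  dihedral-lifts σ (inj₁ σ≗id)   = reflect 0 , reflect-dihedral 0 , λ z → trans (reflect-parity 0 z) (sym (σ≗id _))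
  dihedral-lifts σ (inj₂ σ≗swap) = reflect 1 , reflect-dihedral 1 , λ z → trans (reflect-parity 1 z) (sym (σ≗swap _))

  parity-inject≤ : (2≤m : 2 ≤ m) → ∀ β → parity (inject≤ β 2≤m) ≡ β
  parity-inject≤ 2≤m β = toℕ-injective (trans (toℕ-parity (inject≤ β 2≤m))
    (trans (cong (_% 2) (toℕ-inject≤ β 2≤m)) (m<n⇒m%n≡m (toℕ<n β))))

  sameParity-recolouring : ∀ {x j} → parity x ≡ parity j → EdgeRecolouring (Dihedral m) x j
  sameParity-recolouring {x} {j} x~j =
    reflections-recolour (gap / 2) (Congruence.≡⇒≋ m (halve-even gap gap-even))
    where
      open ≡-Reasoning
      gap = toℕ j + (m ∸ toℕ x)
      x%2≡j%2 : toℕ x % 2 ≡ toℕ j % 2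
      x%2≡j%2 = trans (sym (toℕ-parity x)) (trans (cong toℕ x~j) (toℕ-parity j))
      double : ∀ x → x + x ≡ x * 2
      double = solve-∀
      gap-even : gap % 2 ≡ 0
      gap-even = begin
        gap % 2                        ≡⟨ +∸-parity (toℕ j) (toℕ x) (<⇒≤ (toℕ<n x)) ⟩
        (toℕ j + toℕ x) % 2            ≡⟨ Mod₂.%-eq (Mod₂.+-congʳ {toℕ x} {toℕ j} (toℕ x) (Mod₂.mod-eq x%2≡j%2)) ⟨
        (toℕ x + toℕ x) % 2            ≡⟨ cong (_% 2) (double (toℕ x)) ⟩
        (toℕ x * 2) % 2                ≡⟨ m*n%n≡0 (toℕ x) 2 ⟩
        0                              ∎

¬RamseyProp-below : ∀ {a : Fin m → ℕ} {K} → Fin m → (∀ i → K < a i) → ¬ RamseyProp Γ a K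
¬RamseyProp-below j K<a R with R (λ _ _ → j) (λ _ _ → refl)
... | d , _ , i , mono = ¬ContainsMono-oversized {d = d} (K<a i) mono

RamseyProp-monochromatic : ∀ {a : Fin m → ℕ} {j} →
  (∀ x → EdgeRecolouring Γ x j) → RamseyProp Γ a (a j)
RamseyProp-monochromatic {j = j} recolour c c-sym
  with monochromaticClique (λ _ → ⊤) tt (λ x _ → recolour x) id (λ _ _ → id) c c-sym (λ _ _ _ → tt)
... | d , chain , mono = d , chain , j , mono

RamseyProp-lift : ∀ {g : Fin m → Fin k} {a : Fin m → ℕ} {b : Fin k → ℕ} {N} →
  (∀ σ → Δ σ → Σ _ λ π → Γ π × Intertwines g π σ) →
  (∀ β → Σ (Fin m) λ j → g j ≡ β × a j ≡ b β × (∀ x → g x ≡ β → EdgeRecolouring Γ x j)) →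
  RamseyProp Δ b N → RamseyProp Γ a N
RamseyProp-lift {g = g} lifts representative R c c-sym
  with R (mapColours g c) (λ x y → cong g (c-sym x y))
... | e , chainΔ , β , h , h-injective , h-mono
  with lift-SwitchEquiv lifts (λ _ _ → refl) chainΔ | representative β
... | c′ , chain′ , e≗ | j , gj≡β , aj≡bβ , recolour
  with monochromaticClique (λ x → g x ≡ β) gj≡β recolour h h-injective c′ (SwitchEquiv-symmetric chain′ c-sym)
         (λ p q p≢q → trans (sym (e≗ _ _)) (h-mono p q p≢q))
... | d , chain , mono = d , chain′ ◅◅ chain , j , subst (λ s → ContainsMono d s j) (sym aj≡bβ) mono

RamseyProp-descend : ∀ {g : Fin m → Fin k} {a : Fin m → ℕ} {b : Fin k → ℕ} {K} →
  (∀ π → Γ π → Σ _ λ σ → Δ σ × Intertwines g π σ) →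
  (e : Fin k → Fin m) → (∀ β → g (e β) ≡ β) → (∀ i → b (g i) ≤ a i) →
  RamseyProp Γ a K → RamseyProp Δ b K
RamseyProp-descend {g = g} descends e g∘e≗id b≤a R c c-sym
  with R (mapColours e c) (λ x y → cong e (c-sym x y))
... | d , chain , i , mono with map-SwitchEquiv descends (λ x y → sym (g∘e≗id (c x y))) chain
... | d₀ , chain₀ , d₀≗ = d₀ , chain₀ , g i , ContainsMono-≤ {d = d₀} (b≤a i) (ContainsMono-map {d = d} d₀≗ mono)

theorem11 : (m : ℕ) → 3 ≤ m → (a : Fin m → ℕ) → (∀ i → 2 ≤ a i) →
    ((m % 2 ≡ 1) → (μ : ℕ) → Σ (Fin m) (λ j → a j ≡ μ) → (∀ i → μ ≤ a i) →
      IsR (Dihedral m) a μ)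
    × ((m % 2 ≡ 0) → (n₁ n₂ : ℕ) →
      Σ (Fin m) (λ j → toℕ j % 2 ≡ 0 × a j ≡ n₁) → (∀ i → toℕ i % 2 ≡ 0 → n₁ ≤ a i) →
      Σ (Fin m) (λ j → toℕ j % 2 ≡ 1 × a j ≡ n₂) → (∀ i → toℕ i % 2 ≡ 1 → n₂ ≤ a i) →
      (N : ℕ) → IsR Sym2 (pair n₁ n₂) N →
      Σ ℕ (λ M → IsR (Dihedral m) a M × M ≤ N))
theorem11 m 3≤m a _ = odd , even
  where
    instance
      m-nonZero : NonZero m
      m-nonZero = >-nonZero (≤-trans (s≤s z≤n) 3≤m)
    open Reflections m

    odd : _
    odd m-odd μ (j , refl) μ≤a =
      RamseyProp-monochromatic (λ x → odd-recolouring m-odd x j) ,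
      λ K K<μ → ¬RamseyProp-below j (λ i → <-≤-trans K<μ (μ≤a i))

    even : _
    even m-even n₁ n₂ (j₁ , j₁-even , aj₁) n₁≤a (j₂ , j₂-odd , aj₂) n₂≤a N (R , R-least) =
      N , (RamseyProp-lift dihedral-lifts representative R , lower) , ≤-refl
      where
        open Parity m (m%n≡0⇒n∣m m 2 m-even)
        Representative : Fin 2 → Set
        Representative β = Σ (Fin m) λ j →
          parity j ≡ β × a j ≡ pair n₁ n₂ β × (∀ x → parity x ≡ β → EdgeRecolouring (Dihedral m) x j)
        representative-of : ∀ j {β} → toℕ j % 2 ≡ toℕ β → a j ≡ pair n₁ n₂ β → Representative β
        representative-of j j∈β aj = j , j-parity , aj , λ x x∈β → sameParity-recolouring (trans x∈β (sym j-parity))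
          where j-parity = toℕ-injective (trans (toℕ-parity j) j∈β)
        representative : ∀ β → Representative β
        representative fzero        = representative-of j₁ j₁-even aj₁
        representative (fsuc fzero) = representative-of j₂ j₂-odd aj₂
        pair≤a : ∀ i → pair n₁ n₂ (parity i) ≤ a i
        pair≤a i with parity i in eq
        ... | fzero      = n₁≤a i (trans (sym (toℕ-parity i)) (cong toℕ eq))
        ... | fsuc fzero = n₂≤a i (trans (sym (toℕ-parity i)) (cong toℕ eq))
        lower : ∀ K → K < N → ¬ RamseyProp (Dihedral m) a K
        lower K K<N R′ = R-least K K<N
          (RamseyProp-descend dihedral-descends (λ β → inject≤ β 2≤m) (parity-inject≤ 2≤m) pair≤a R′)
          where
            2≤m : 2 ≤ m
            2≤m = ≤-trans (n≤1+n 2) 3≤m
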